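{- Let \(\Gamma\) be a set of Horn clauses over a signature \(\Delta\), let \(\Gamma_0 = \{\rho \mid \rho \text{ atomic sentence over } \Delta,\ \Gamma \models \rho\}\), and let \((W^{\Gamma_0}, M^{\Gamma_0})\) be a reachable initial model of \(\Gamma_0\). Then \((W^{\Gamma_0}, M^{\Gamma_0})\) is also an initial model of \(\Gamma\).
   Context: Signatures: \(\Delta = (\Sigma^{n}, \Sigma^{r} \subseteq \Sigma)\), where \(\Sigma^{n} = (\{\star\}, F^{n}, P^{n})\) is a one-sorted first-order signature of nominals and \(\Sigma^{r} = (S^{r},F^{r},P^{r}) \subseteq \Sigma = (S,F,P)\) are many-sorted first-order signatures; symbols in \(\Sigma^{r}\) are rigid, the others (\(F^{f}, P^{f}\)) flexible. A \(\Delta\)-model is \((W,M)\) with \(W\) a \(\Sigma^{n}\)-model, \(|W|\) the carrier of \(\star\) (worlds), and \(M=\{M_w\}_{w\in|W|}\) \(\Sigma\)-models interpreting all rigid symbols identically. A \(\Delta\)-homomorphism \((W,M)\to(W',M')\) is a \(\Sigma^{n}\)-homomorphism \(h\colon W\to W'\) with \(\Sigma\)-homomorphisms \(h_w\colon M_w\to M'_{h(w)}\) coinciding on rigid sorts. An initial model of a set of sentences is a model of it with exactly one homomorphism into every model of it. A model is reachable if every world is the value \(W_k\) of a ground nominal term \(k\) and every element of \(M_{W_k}\) is the value of a hybrid term in \(T^{\Delta}_k\). Hybrid terms \(T^{\Delta}_k\) at a ground nominal term \(k\): least family with \(\sigma(t)\in T^{\Delta}_{k,s}\) for rigid \(\sigma\in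 F^{r}_{ar\to s}\), \(\sigma(k,t)\in T^{\Delta}_{k,s}\) for flexible \(\sigma\), \(t\in T^{\Delta}_{k,ar}\), and \(T^{\Delta}_{k_0,s}\subseteq T^{\Delta}_{k,s}\) for rigid sorts \(s\). \((W,M)_t\in M_{W_k}\) is the value of \(t\in T^{\Delta}_k\). Atomic sentences (world-independent satisfaction): \(k_1 = k_2\) (\(W_{k_1}=W_{k_2}\)); \(\lambda(k)\), \(\lambda\in P^n\) (\(W_k\in W_\lambda\)); \(t_1 =_k t_2\) (\((W,M)_{t_1}=(W,M)_{t_2}\)); \(\varpi(t)\), \(\varpi\in P^r\) (\((W,M)_t\in M_{w,\varpi}\)); \(\pi(k,t)\), \(\pi\in P^f\) (\((W,M)_t\in M_{W_k,\pi}\)). Actions: \(\mathfrak{a} ::= \lambda \mid \mathfrak{a};\mathfrak{a} \mid \mathfrak{a}+\mathfrak{a}\mid\mathfrak{a}^*\), \(\lambda\in P^n_{\star\star}\), interpreted by composition, union, reflexive-transitive closure; action relation \(\mathfrak{a}(k_1,k_2)\) holds iff \((W_{k_1},W_{k_2})\in W_{\mathfrak{a}}\). Further sentences and satisfaction at world \(w\): \(@_k\gamma\): \(\gamma\) holds at \(W_k\); implication as usual; \(\downarrow z.\gamma\) (\(z\) a nominal variable added as a constant to \(F^n\)): \(\gamma\) holds at \(w\) in the expansion interpreting \(z\) as \(w\); \(\forall X.\gamma\) (\(X\) a set of nominal variables and variables of rigid sorts, added as new constants to \(F^n\), resp. \(F^r\)): \(\gamma\) holds at \(w\) in every \(\Delta[X]\)-expansion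 (same carriers, arbitrary values for the new constants); \([\mathfrak{a}]\gamma\): \(\gamma\) holds at all \(w'\) with \((w,w')\in W_{\mathfrak{a}}\); \(\langle\sigma\rangle\gamma\) (\(\sigma\) unary in \(F^n\)): \(\gamma\) holds at \(W_\sigma(w)\). Horn clauses: sentences obtained from atomic sentences by repeated application of \(@_k\), implication \(\bigwedge H \Rightarrow \gamma\) with \(H\) a finite set of atomic sentences or action relations, \(\downarrow z\), \(\forall X\), \([\mathfrak{a}]\), \(\langle\sigma\rangle\). \((W,M)\models\gamma\) means satisfaction at every world; \(\Gamma\models\gamma\) means every model of \(\Gamma\) satisfies \(\gamma\). -}

module Defs where

open import Level using (Level; 0ℓ) renaming (suc to lsuc)
open import Data.Nat using (ℕ; zero; suc)
open import Data.Unit using (⊤; tt)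
open import Data.Empty using (⊥)
open import Data.Product using (Σ; _×_; _,_)
open import Data.Sum using (_⊎_; inj₁; inj₂)
open import Data.List using (List; []; _∷_)
open import Data.List.Relation.Unary.All as All using (All; []; _∷_)
open import Data.Vec as Vec using (Vec; []; _∷_)
open import Relation.Binary.PropositionalEquality using (_≡_; subst)
open import Relation.Binary.Construct.Closure.ReflexiveTransitive using (Star)

-- Signatures Δ = (Σⁿ, Σʳ ⊆ Σ)
-- Σⁿ : one sort ⋆, nominal function symbols FunN n (arity n) and
--      nominal predicate symbols PredN n.
-- Σ  : sorts S = SortR ⊎ SortF (rigid sorts Sʳ and the remaining,
--      flexible, sorts); rigid function / predicate symbols (of Σʳ, hence
--      over rigid sorts only) and flexible ones (over arbitrary sorts).

record Sig : Set₁ where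
  field
    FunN  : ℕ → Set
    PredN : ℕ → Set
    SortR : Set
    SortF : Set
    FunR  : List SortR → SortR → Set
    PredR : List SortR → Set
    FunF  : List (SortR ⊎ SortF) → (SortR ⊎ SortF) → Set
    PredF : List (SortR ⊎ SortF) → Set
open Sig public

Sort : Sig → Set
Sort Δ = SortR Δ ⊎ SortF Δ

record Vars (Δ : Sig) : Set₁ where
  field
    NV : Set
    RV : SortR Δ → Set
open Vars public

data ExtN (F : ℕ → Set) (V : Set) : ℕ → Set where
  old : ∀ {n} → F n → ExtN F V n
  new : V → ExtN F V zero

data ExtR {S : Set} (F : List S → S → Set) (V : S → Set) : List S → S → Set where
  old : ∀ {ar s} → F ar s → ExtR F V ar s
  new : ∀ {s} → V s → ExtR F V [] s

_[_] : (Δ : Sig) → Vars Δ → Sig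
Δ [ X ] = record
  { FunN  = ExtN (FunN Δ) (NV X)
  ; PredN = PredN Δ
  ; SortR = SortR Δ
  ; SortF = SortF Δ
  ; FunR  = ExtR (FunR Δ) (RV X)
  ; PredR = PredR Δ
  ; FunF  = FunF Δ
  ; PredF = PredF Δ
  }

oneNom : (Δ : Sig) → Vars Δ
oneNom Δ = record { NV = ⊤ ; RV = λ _ → ⊥ }

CarOf : ∀ {SR SF : Set} → (SR → Set) → (SF → Set) → SR ⊎ SF → Set
CarOf RC FC (inj₁ s) = RC s
CarOf RC FC (inj₂ s) = FC s

record Model (Δ : Sig) : Set₁ where
  field
    W  : Set
    nf : ∀ {n} → FunN Δ n → Vec W n → W
    np : ∀ {n} → PredN Δ n → Vec W n → Set
    RC : SortR Δ → Set
    FC : W → SortF Δ → Set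
    rf : ∀ {ar s} → FunR Δ ar s → All RC ar → RC s
    rp : ∀ {ar} → PredR Δ ar → All RC ar → Set
    ff : ∀ (w : W) {ar s} → FunF Δ ar s → All (CarOf RC (FC w)) ar → CarOf RC (FC w) s
    fp : ∀ (w : W) {ar} → PredF Δ ar → All (CarOf RC (FC w)) ar → Set
open Model public

Car : ∀ {Δ} (M : Model Δ) → W M → Sort Δ → Set
Car M w = CarOf (RC M) (FC M w)

module _ {Δ : Sig} (X : Vars Δ) (M : Model Δ)
         (vn : NV X → W M) (vr : ∀ {s} → RV X s → RC M s) where
  private
    nf′ : ∀ {n} → ExtN (FunN Δ) (NV X) n → Vec (W M) n → W M
    nf′ (old σ) ws = nf M σ ws
    nf′ (new x) [] = vn x
    rf′ : ∀ {ar s} → ExtR (FunR Δ) (RV X) ar s → All (RC M) ar → RC M s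
    rf′ (old σ) as = rf M σ as
    rf′ (new x) [] = vr x

  expand : Model (Δ [ X ])
  expand = record
    { W = W M ; nf = nf′ ; np = np M ; RC = RC M ; FC = FC M
    ; rf = rf′ ; rp = rp M ; ff = ff M ; fp = fp M }

carMap : ∀ {Δ} (M N : Model Δ) {w : W M} {w′ : W N} →
         (∀ {s} → RC M s → RC N s) → (∀ {s} → FC M w s → FC N w′ s) →
         ∀ {s} → Car M w s → Car N w′ s
carMap M N hr hf {inj₁ s} x = hr x
carMap M N hr hf {inj₂ s} x = hf x

record Hom {Δ : Sig} (M N : Model Δ) : Set where
  field
    h    : W M → W N
    h-nf : ∀ {n} (σ : FunN Δ n) (ws : Vec (W M) n) →
           h (nf M σ ws) ≡ nf N σ (Vec.map h ws)
    h-np : ∀ {n} (σ : PredN Δ n) (ws : Vec (W M) n) →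
           np M σ ws → np N σ (Vec.map h ws)
    hr   : ∀ {s} → RC M s → RC N s
    hf   : ∀ (w : W M) {s} → FC M w s → FC N (h w) s
    hr-f : ∀ {ar s} (σ : FunR Δ ar s) (as : All (RC M) ar) →
           hr (rf M σ as) ≡ rf N σ (All.map hr as)
    hr-p : ∀ {ar} (σ : PredR Δ ar) (as : All (RC M) ar) →
           rp M σ as → rp N σ (All.map hr as)
    hf-f : ∀ (w : W M) {ar s} (σ : FunF Δ ar s) (as : All (Car M w) ar) →
           carMap M N hr (hf w) {s} (ff M w σ as)
             ≡ ff N (h w) σ (All.map (λ {s′} x → carMap M N hr (hf w) {s′} x) as)
    hf-p : ∀ (w : W M) {ar} (σ : PredF Δ ar) (as : All (Car M w) ar) →
           fp M w σ as → fp N (h w) σ (All.map (λ {s′} x → carMap M N hr (hf w) {s′} x) as)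
open Hom public

_≈ₕ_ : ∀ {Δ} {M N : Model Δ} → Hom M N → Hom M N → Set
_≈ₕ_ {Δ} {M} {N} f g =
  Σ (∀ w → h f w ≡ h g w) λ eqW →
    (∀ {s} (x : RC M s) → hr f x ≡ hr g x) ×
    (∀ w {s} (x : FC M w s) → subst (λ v → FC N v s) (eqW w) (hf f w x) ≡ hf g w x)

mutual
  data NTerm (Δ : Sig) : Set where
    app : ∀ {n} → FunN Δ n → NTerms Δ n → NTerm Δ

  data NTerms (Δ : Sig) : ℕ → Set where
    []  : NTerms Δ zero
    _∷_ : ∀ {n} → NTerm Δ → NTerms Δ n → NTerms Δ (suc n)

mutual
  data HTerm (Δ : Sig) : NTerm Δ → Sort Δ → Set where
    rig   : ∀ {k ar s} → FunR Δ ar s → RArgs Δ k ar → HTerm Δ k (inj₁ s)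
    flex  : ∀ {k ar s} → FunF Δ ar s → Args Δ k ar → HTerm Δ k s
    -- T^Δ_{k₀,s} ⊆ T^Δ_{k,s} for rigid sorts s
    shift : ∀ {k s} (k₀ : NTerm Δ) → HTerm Δ k₀ (inj₁ s) → HTerm Δ k (inj₁ s)

  data RArgs (Δ : Sig) (k : NTerm Δ) : List (SortR Δ) → Set where
    []  : RArgs Δ k []
    _∷_ : ∀ {s ar} → HTerm Δ k (inj₁ s) → RArgs Δ k ar → RArgs Δ k (s ∷ ar)

  data Args (Δ : Sig) (k : NTerm Δ) : List (Sort Δ) → Set where
    []  : Args Δ k []
    _∷_ : ∀ {s ar} → HTerm Δ k s → Args Δ k ar → Args Δ k (s ∷ ar)

data Action (Δ : Sig) : Set where
  act  : PredN Δ 2 → Action Δ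
  _⨾_  : Action Δ → Action Δ → Action Δ
  _⊕_  : Action Δ → Action Δ → Action Δ
  _⋆   : Action Δ → Action Δ

data Atom (Δ : Sig) : Set where
  _≐_  : NTerm Δ → NTerm Δ → Atom Δ
  npr  : PredN Δ 1 → NTerm Δ → Atom Δ
  teq  : ∀ (k : NTerm Δ) {s} → HTerm Δ k s → HTerm Δ k s → Atom Δ
  rpr  : ∀ (k : NTerm Δ) {ar} → PredR Δ ar → RArgs Δ k ar → Atom Δ
  fpr  : ∀ (k : NTerm Δ) {ar} → PredF Δ ar → Args Δ k ar → Atom Δ

data Hyp (Δ : Sig) : Set where
  atomH : Atom Δ → Hyp Δ
  actH  : Action Δ → NTerm Δ → NTerm Δ → Hyp Δ

data Horn : Sig → Set₁ where
  atom : ∀ {Δ} → Atom Δ → Horn Δ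
  at   : ∀ {Δ} → NTerm Δ → Horn Δ → Horn Δ
  imp  : ∀ {Δ} → List (Hyp Δ) → Horn Δ → Horn Δ
  bind : ∀ {Δ} → Horn (Δ [ oneNom Δ ]) → Horn Δ
  all  : ∀ {Δ} (X : Vars Δ) → Horn (Δ [ X ]) → Horn Δ
  box  : ∀ {Δ} → Action Δ → Horn Δ → Horn Δ
  dia  : ∀ {Δ} → FunN Δ 1 → Horn Δ → Horn Δ

module _ {Δ : Sig} (M : Model Δ) where
  mutual
    ⟦_⟧ₙ : NTerm Δ → W M
    ⟦ app σ ks ⟧ₙ = nf M σ ⟦ ks ⟧ₙₛ

    ⟦_⟧ₙₛ : ∀ {n} → NTerms Δ n → Vec (W M) n
    ⟦ [] ⟧ₙₛ = []
    ⟦ k ∷ ks ⟧ₙₛ = ⟦ k ⟧ₙ ∷ ⟦ ks ⟧ₙₛ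

  mutual
    ⟦_⟧ₜ : ∀ {k s} → HTerm Δ k s → Car M ⟦ k ⟧ₙ s
    ⟦ rig σ ts ⟧ₜ = rf M σ ⟦ ts ⟧ᵣ
    ⟦ flex {k} σ ts ⟧ₜ = ff M ⟦ k ⟧ₙ σ ⟦ ts ⟧ₐ
    ⟦ shift k₀ t ⟧ₜ = ⟦ t ⟧ₜ

    ⟦_⟧ᵣ : ∀ {k ar} → RArgs Δ k ar → All (RC M) ar
    ⟦ [] ⟧ᵣ = []
    ⟦ t ∷ ts ⟧ᵣ = ⟦ t ⟧ₜ ∷ ⟦ ts ⟧ᵣ

    ⟦_⟧ₐ : ∀ {k ar} → Args Δ k ar → All (Car M ⟦ k ⟧ₙ) ar
    ⟦ [] ⟧ₐ = []
    ⟦ t ∷ ts ⟧ₐ = ⟦ t ⟧ₜ ∷ ⟦ ts ⟧ₐ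

  ARel : Action Δ → W M → W M → Set
  ARel (act λ′) w w′ = np M λ′ (w ∷ w′ ∷ [])
  ARel (a ⨾ b) w w′ = Σ (W M) λ v → ARel a w v × ARel b v w′
  ARel (a ⊕ b) w w′ = ARel a w w′ ⊎ ARel b w w′
  ARel (a ⋆) w w′ = Star (ARel a) w w′

  ASat : Atom Δ → Set
  ASat (k₁ ≐ k₂) = ⟦ k₁ ⟧ₙ ≡ ⟦ k₂ ⟧ₙ
  ASat (npr λ′ k) = np M λ′ (⟦ k ⟧ₙ ∷ [])
  ASat (teq k t₁ t₂) = ⟦ t₁ ⟧ₜ ≡ ⟦ t₂ ⟧ₜ
  ASat (rpr k ϖ ts) = rp M ϖ ⟦ ts ⟧ᵣ
  ASat (fpr k π ts) = fp M ⟦ k ⟧ₙ π ⟦ ts ⟧ₐ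

  HSat : Hyp Δ → Set
  HSat (atomH ρ) = ASat ρ
  HSat (actH a k₁ k₂) = ARel a ⟦ k₁ ⟧ₙ ⟦ k₂ ⟧ₙ

Sat : ∀ {Δ} (M : Model Δ) → W M → Horn Δ → Set
Sat M w (atom ρ) = ASat M ρ
Sat M w (at k γ) = Sat M (⟦_⟧ₙ M k) γ
Sat M w (imp H γ) = All (HSat M) H → Sat M w γ
Sat {Δ} M w (bind γ) = Sat (expand (oneNom Δ) M (λ _ → w) (λ ())) w γ
Sat M w (all X γ) =
  (vn : NV X → W M) (vr : ∀ {s} → RV X s → RC M s) → Sat (expand X M vn vr) w γ
Sat M w (box a γ) = ∀ w′ → ARel M a w w′ → Sat M w′ γ
Sat M w (dia σ γ) = Sat M (nf M σ (w ∷ [])) γ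

_⊨_ : ∀ {Δ} → Model Δ → Horn Δ → Set
M ⊨ γ = ∀ w → Sat M w γ

ModelOf : ∀ {Δ ℓ} → (Horn Δ → Set ℓ) → Model Δ → Set (ℓ Level.⊔ lsuc 0ℓ) 
ModelOf {Δ} Γ M = ∀ (γ : Horn Δ) → Γ γ → M ⊨ γ

_⊨ₛ_ : ∀ {Δ ℓ} → (Horn Δ → Set ℓ) → Horn Δ → Set (ℓ Level.⊔ lsuc 0ℓ)
Γ ⊨ₛ γ = ∀ M → ModelOf Γ M → M ⊨ γ

Γ₀ : ∀ {Δ ℓ} → (Horn Δ → Set ℓ) → Horn Δ → Set (ℓ Level.⊔ lsuc 0ℓ)
Γ₀ {Δ} Γ γ = Σ (Atom Δ) λ ρ → (γ ≡ atom ρ) × (Γ ⊨ₛ atom ρ)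

IsInitial : ∀ {Δ ℓ} → (Horn Δ → Set ℓ) → Model Δ → Set (ℓ Level.⊔ lsuc 0ℓ)
IsInitial {Δ} Γ M =
  ModelOf Γ M ×
  (∀ (N : Model Δ) → ModelOf Γ N → Σ (Hom M N) λ f → ∀ (g : Hom M N) → f ≈ₕ g)

Reachable : ∀ {Δ} → Model Δ → Set
Reachable {Δ} M =
  (∀ (w : W M) → Σ (NTerm Δ) λ k → ⟦_⟧ₙ M k ≡ w) ×
  (∀ (k : NTerm Δ) {s} (x : Car M (⟦_⟧ₙ M k) s) →
     Σ (HTerm Δ k s) λ t → ⟦_⟧ₜ M t ≡ x)

-- Every model N of Γ is a model of Γ₀, so M has a unique homomorphism into N
-- and it only remains to show M ⊨ Γ.  By induction on a Horn clause γ: if γ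
-- holds at the value of a nominal term k in every model of Γ, then it holds at
-- the value of k in M.  An atom true in all models of Γ belongs to Γ₀; the
-- hypotheses of an implication are carried forward along the homomorphisms
-- M → N; and for [𝔞], ↓ and ∀, reachability names every world and every rigid
-- element of M by a term, so the same term provides the matching instance in
-- each N.  The induction then continues in the expanded signature, where
-- substituting the naming terms back reduces atoms to atoms over Δ.
module Submission where

open import Level using (Level)
open import Defs
open import Data.Product using (Σ; _,_; proj₁; proj₂)
open import Data.Sum using (inj₁; inj₂)
open import Data.List using ([]; _∷_)
open import Data.List.Relation.Unary.All as All using (All; []; _∷_)
open import Data.List.Relation.Unary.All.Properties using (map-cong)
open import Data.Vec as Vec using (Vec; []; _∷_)
open import Relation.Binary.PropositionalEquality hiding ([_])
open import Relation.Binary.PropositionalEquality.Properties using (subst-injective)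
open import Relation.Binary.Construct.Closure.ReflexiveTransitive using (gmap)

module Transport {Δ : Sig} (M : Model Δ) where

  castCar : ∀ {w w′} → w ≡ w′ → ∀ {s} → Car M w s → Car M w′ s
  castCar e {s} = subst (λ v → Car M v s) e

  castArgs : ∀ {w w′} → w ≡ w′ → ∀ {ar} → All (Car M w) ar → All (Car M w′) ar
  castArgs e [] = []
  castArgs e (_∷_ {s} x xs) = castCar e {s} x ∷ castArgs e xs

  castArgs-refl : ∀ {w ar} (xs : All (Car M w) ar) → castArgs refl xs ≡ xs
  castArgs-refl [] = refl
  castArgs-refl (x ∷ xs) = cong (x ∷_) (castArgs-refl xs)

  castCar-rigid : ∀ {w w′ s} (e : w ≡ w′) (x : RC M s) → castCar e {inj₁ s} x ≡ x
  castCar-rigid refl x = refl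

  castCar-injective : ∀ {w w′ s} (e : w ≡ w′) {x y : Car M w s} →
                      castCar e {s} x ≡ castCar e {s} y → x ≡ y
  castCar-injective e = subst-injective e

  ff-cast : ∀ {w w′ ar s} (σ : FunF Δ ar s) (e : w ≡ w′) {xs ys} → castArgs e xs ≡ ys →
            castCar e {s} (ff M w σ xs) ≡ ff M w′ σ ys
  ff-cast σ refl {xs} q = cong (ff M _ σ) (trans (sym (castArgs-refl xs)) q)

  fp-cast : ∀ {w w′ ar} (π : PredF Δ ar) (e : w ≡ w′) {xs ys} → castArgs e xs ≡ ys →
            fp M w π xs → fp M w′ π ys
  fp-cast π refl {xs} q = subst (fp M _ π) (trans (sym (castArgs-refl xs)) q)

  fp-uncast : ∀ {w w′ ar} (π : PredF Δ ar) (e : w ≡ w′) {xs ys} → castArgs e xs ≡ ys →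
              fp M w′ π ys → fp M w π xs
  fp-uncast π refl {xs} q = subst (fp M _ π) (sym (trans (sym (castArgs-refl xs)) q))

open Transport

module HomPreservation {Δ : Sig} {M N : Model Δ} (f : Hom M N) where

  mutual
    hom-⟦⟧ₙ : ∀ k → h f (⟦_⟧ₙ M k) ≡ ⟦_⟧ₙ N k
    hom-⟦⟧ₙ (app σ ks) = trans (h-nf f σ (⟦_⟧ₙₛ M ks)) (cong (nf N σ) (hom-⟦⟧ₙₛ ks))

    hom-⟦⟧ₙₛ : ∀ {n} (ks : NTerms Δ n) → Vec.map (h f) (⟦_⟧ₙₛ M ks) ≡ ⟦_⟧ₙₛ N ks
    hom-⟦⟧ₙₛ [] = refl
    hom-⟦⟧ₙₛ (k ∷ ks) = cong₂ _∷_ (hom-⟦⟧ₙ k) (hom-⟦⟧ₙₛ ks)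

  hCar : ∀ w {s} → Car M w s → Car N (h f w) s
  hCar w {s} = carMap M N (hr f) (hf f w) {s}

  mutual
    hom-⟦⟧ₜ : ∀ {k s} (t : HTerm Δ k s) →
              castCar N (hom-⟦⟧ₙ k) {s} (hCar (⟦_⟧ₙ M k) {s} (⟦_⟧ₜ M t)) ≡ ⟦_⟧ₜ N t
    hom-⟦⟧ₜ {k} (rig σ ts) =
      trans (castCar-rigid N (hom-⟦⟧ₙ k) _) (trans (hr-f f σ _) (cong (rf N σ) (hom-⟦⟧ᵣ ts)))
    hom-⟦⟧ₜ {k} {s} (flex σ ts) =
      trans (cong (castCar N (hom-⟦⟧ₙ k) {s}) (hf-f f (⟦_⟧ₙ M k) σ (⟦_⟧ₐ M ts)))
            (ff-cast N σ (hom-⟦⟧ₙ k) (hom-⟦⟧ₐ ts))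
    hom-⟦⟧ₜ {k} (shift k₀ t) = trans (castCar-rigid N (hom-⟦⟧ₙ k) _) (hom-⟦⟧ₜ-rigid t)

    hom-⟦⟧ₜ-rigid : ∀ {k s} (t : HTerm Δ k (inj₁ s)) → hr f (⟦_⟧ₜ M t) ≡ ⟦_⟧ₜ N t
    hom-⟦⟧ₜ-rigid {k} t = trans (sym (castCar-rigid N (hom-⟦⟧ₙ k) _)) (hom-⟦⟧ₜ t)

    hom-⟦⟧ᵣ : ∀ {k ar} (ts : RArgs Δ k ar) → All.map (hr f) (⟦_⟧ᵣ M ts) ≡ ⟦_⟧ᵣ N ts
    hom-⟦⟧ᵣ [] = refl
    hom-⟦⟧ᵣ (t ∷ ts) = cong₂ _∷_ (hom-⟦⟧ₜ-rigid t) (hom-⟦⟧ᵣ ts)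

    hom-⟦⟧ₐ : ∀ {k ar} (ts : Args Δ k ar) →
              castArgs N (hom-⟦⟧ₙ k) (All.map (λ {s} → hCar (⟦_⟧ₙ M k) {s}) (⟦_⟧ₐ M ts)) ≡ ⟦_⟧ₐ N ts
    hom-⟦⟧ₐ [] = refl
    hom-⟦⟧ₐ (t ∷ ts) = cong₂ _∷_ (hom-⟦⟧ₜ t) (hom-⟦⟧ₐ ts)

  hom-ASat : ∀ ρ → ASat M ρ → ASat N ρ
  hom-ASat (k₁ ≐ k₂) p = trans (sym (hom-⟦⟧ₙ k₁)) (trans (cong (h f) p) (hom-⟦⟧ₙ k₂))
  hom-ASat (npr l k) p =
    subst (λ v → np N l (v ∷ [])) (hom-⟦⟧ₙ k) (h-np f l (⟦_⟧ₙ M k ∷ []) p)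
  hom-ASat (teq k {s} t₁ t₂) p =
    trans (sym (hom-⟦⟧ₜ t₁))
          (trans (cong (λ x → castCar N (hom-⟦⟧ₙ k) {s} (hCar (⟦_⟧ₙ M k) {s} x)) p) (hom-⟦⟧ₜ t₂))
  hom-ASat (rpr k ϖ ts) p = subst (rp N ϖ) (hom-⟦⟧ᵣ ts) (hr-p f ϖ _ p)
  hom-ASat (fpr k π ts) p = fp-cast N π (hom-⟦⟧ₙ k) (hom-⟦⟧ₐ ts) (hf-p f _ π _ p)

  hom-ARel : ∀ a {w w′} → ARel M a w w′ → ARel N a (h f w) (h f w′)
  hom-ARel (act l) {w} {w′} = h-np f l (w ∷ w′ ∷ [])
  hom-ARel (a ⨾ b) (v , p , q) = h f v , hom-ARel a p , hom-ARel b q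
  hom-ARel (a ⊕ b) (inj₁ p) = inj₁ (hom-ARel a p)
  hom-ARel (a ⊕ b) (inj₂ p) = inj₂ (hom-ARel b p)
  hom-ARel (a ⋆) = gmap (h f) (hom-ARel a)

  hom-HSat : ∀ {H} → HSat M H → HSat N H
  hom-HSat {atomH ρ} = hom-ASat ρ
  hom-HSat {actH a k₁ k₂} p = subst₂ (ARel N a) (hom-⟦⟧ₙ k₁) (hom-⟦⟧ₙ k₂) (hom-ARel a p)

open HomPreservation

expand-Hom : ∀ {Δ} (X : Vars Δ) {M N : Model Δ} (f : Hom M N)
             {vn : NV X → W M} {vr : ∀ {s} → RV X s → RC M s}
             {un : NV X → W N} {ur : ∀ {s} → RV X s → RC N s} →
             (∀ x → h f (vn x) ≡ un x) → (∀ {s} (x : RV X s) → hr f (vr x) ≡ ur x) →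
             Hom (expand X M vn vr) (expand X N un ur)
expand-Hom {Δ} X {M} {N} f {vn} {vr} {un} {ur} f-vn f-vr = record
  { h = h f ; h-nf = h-nf′ ; h-np = h-np f ; hr = hr f ; hf = hf f
  ; hr-f = hr-f′ ; hr-p = hr-p f ; hf-f = hf-f′ ; hf-p = hf-p′ }
  where
    M′ = expand X M vn vr
    N′ = expand X N un ur

    h-nf′ : ∀ {n} (σ : FunN (Δ [ X ]) n) (ws : Vec (W M) n) →
            h f (nf M′ σ ws) ≡ nf N′ σ (Vec.map (h f) ws)
    h-nf′ (old σ) = h-nf f σ
    h-nf′ (new x) [] = f-vn x

    hr-f′ : ∀ {ar s} (σ : FunR (Δ [ X ]) ar s) (xs : All (RC M) ar) →
            hr f (rf M′ σ xs) ≡ rf N′ σ (All.map (hr f) xs)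
    hr-f′ (old σ) = hr-f f σ
    hr-f′ (new x) [] = f-vr x

    hCar′ : ∀ w {s} → Car M w s → Car N (h f w) s
    hCar′ w {s} = carMap M′ N′ (hr f) (hf f w) {s}

    hCar′≡hCar : ∀ w {s} (x : Car M w s) → hCar′ w {s} x ≡ hCar f w {s} x
    hCar′≡hCar w {inj₁ s} x = refl
    hCar′≡hCar w {inj₂ s} x = refl

    hf-f′ : ∀ w {ar s} (σ : FunF Δ ar s) (xs : All (Car M w) ar) →
            hCar′ w {s} (ff M w σ xs) ≡ ff N (h f w) σ (All.map (λ {s} → hCar′ w {s}) xs)
    hf-f′ w {s = s} σ xs = trans (hCar′≡hCar w {s} _)
      (trans (hf-f f w σ xs) (cong (ff N (h f w) σ) (sym (map-cong xs (λ {s} → hCar′≡hCar w {s})))))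

    hf-p′ : ∀ w {ar} (π : PredF Δ ar) (xs : All (Car M w) ar) →
            fp M w π xs → fp N (h f w) π (All.map (λ {s} → hCar′ w {s}) xs)
    hf-p′ w π xs p = subst (fp N (h f w) π) (sym (map-cong xs (λ {s} → hCar′≡hCar w {s}))) (hf-p f w π xs p)

record Instantiation {Δ : Sig} (X : Vars Δ) : Set where
  field
    base   : NTerm Δ
    nameₙ  : NV X → NTerm Δ
    nameᵣ  : ∀ {s} → RV X s → HTerm Δ base (inj₁ s)
open Instantiation

record Denotes {Δ : Sig} {X : Vars Δ} (M : Model Δ) (θ : Instantiation X)
               (vn : NV X → W M) (vr : ∀ {s} → RV X s → RC M s) : Set where
  field
    nameₙ-≡ : ∀ x → ⟦_⟧ₙ M (nameₙ θ x) ≡ vn x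
    nameᵣ-≡ : ∀ {s} (x : RV X s) → ⟦_⟧ₜ M (nameᵣ θ x) ≡ vr x
open Denotes

module Instantiate {Δ : Sig} {X : Vars Δ} (θ : Instantiation X) where

  mutual
    instₙ : NTerm (Δ [ X ]) → NTerm Δ
    instₙ (app (old σ) ks) = app σ (instₙₛ ks)
    instₙ (app (new x) []) = nameₙ θ x

    instₙₛ : ∀ {n} → NTerms (Δ [ X ]) n → NTerms Δ n
    instₙₛ [] = []
    instₙₛ (k ∷ ks) = instₙ k ∷ instₙₛ ks

  mutual
    instₜ : ∀ {k s} → HTerm (Δ [ X ]) k s → HTerm Δ (instₙ k) s
    instₜ (rig (old σ) ts) = rig σ (instᵣ ts)
    instₜ (rig (new x) []) = shift (base θ) (nameᵣ θ x)
    instₜ (flex σ ts) = flex σ (instₐ ts)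
    instₜ (shift k₀ t) = shift (instₙ k₀) (instₜ t)

    instᵣ : ∀ {k ar} → RArgs (Δ [ X ]) k ar → RArgs Δ (instₙ k) ar
    instᵣ [] = []
    instᵣ (t ∷ ts) = instₜ t ∷ instᵣ ts

    instₐ : ∀ {k ar} → Args (Δ [ X ]) k ar → Args Δ (instₙ k) ar
    instₐ [] = []
    instₐ (t ∷ ts) = instₜ t ∷ instₐ ts

  instAtom : Atom (Δ [ X ]) → Atom Δ
  instAtom (k₁ ≐ k₂) = instₙ k₁ ≐ instₙ k₂
  instAtom (npr l k) = npr l (instₙ k)
  instAtom (teq k t₁ t₂) = teq (instₙ k) (instₜ t₁) (instₜ t₂)
  instAtom (rpr k ϖ ts) = rpr (instₙ k) ϖ (instᵣ ts)
  instAtom (fpr k π ts) = fpr (instₙ k) π (instₐ ts)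

  module _ (M : Model Δ) {vn : NV X → W M} {vr : ∀ {s} → RV X s → RC M s}
           (d : Denotes M θ vn vr) where
    private
      M′ = expand X M vn vr

    mutual
      ⟦instₙ⟧ : ∀ k → ⟦_⟧ₙ M (instₙ k) ≡ ⟦_⟧ₙ M′ k
      ⟦instₙ⟧ (app (old σ) ks) = cong (nf M σ) (⟦instₙₛ⟧ ks)
      ⟦instₙ⟧ (app (new x) []) = nameₙ-≡ d x

      ⟦instₙₛ⟧ : ∀ {n} (ks : NTerms (Δ [ X ]) n) → ⟦_⟧ₙₛ M (instₙₛ ks) ≡ ⟦_⟧ₙₛ M′ ks
      ⟦instₙₛ⟧ [] = refl
      ⟦instₙₛ⟧ (k ∷ ks) = cong₂ _∷_ (⟦instₙ⟧ k) (⟦instₙₛ⟧ ks)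

    mutual
      ⟦instₜ⟧ : ∀ {k s} (t : HTerm (Δ [ X ]) k s) →
                castCar M (⟦instₙ⟧ k) {s} (⟦_⟧ₜ M (instₜ t)) ≡ ⟦_⟧ₜ M′ t
      ⟦instₜ⟧ {k} (rig (old σ) ts) =
        trans (castCar-rigid M (⟦instₙ⟧ k) _) (cong (rf M σ) (⟦instᵣ⟧ ts))
      ⟦instₜ⟧ {k} (rig (new x) []) = trans (castCar-rigid M (⟦instₙ⟧ k) _) (nameᵣ-≡ d x)
      ⟦instₜ⟧ {k} (flex σ ts) = ff-cast M σ (⟦instₙ⟧ k) (⟦instₐ⟧ ts)
      ⟦instₜ⟧ {k} (shift k₀ t) = trans (castCar-rigid M (⟦instₙ⟧ k) _) (⟦instₜ⟧-rigid t)

      ⟦instₜ⟧-rigid : ∀ {k s} (t : HTerm (Δ [ X ]) k (inj₁ s)) →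
                      ⟦_⟧ₜ M (instₜ t) ≡ ⟦_⟧ₜ M′ t
      ⟦instₜ⟧-rigid {k} t = trans (sym (castCar-rigid M (⟦instₙ⟧ k) _)) (⟦instₜ⟧ t)

      ⟦instᵣ⟧ : ∀ {k ar} (ts : RArgs (Δ [ X ]) k ar) → ⟦_⟧ᵣ M (instᵣ ts) ≡ ⟦_⟧ᵣ M′ ts
      ⟦instᵣ⟧ [] = refl
      ⟦instᵣ⟧ (t ∷ ts) = cong₂ _∷_ (⟦instₜ⟧-rigid t) (⟦instᵣ⟧ ts)

      ⟦instₐ⟧ : ∀ {k ar} (ts : Args (Δ [ X ]) k ar) →
                castArgs M (⟦instₙ⟧ k) (⟦_⟧ₐ M (instₐ ts)) ≡ ⟦_⟧ₐ M′ ts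
      ⟦instₐ⟧ [] = refl
      ⟦instₐ⟧ (t ∷ ts) = cong₂ _∷_ (⟦instₜ⟧ t) (⟦instₐ⟧ ts)

    instAtom⁺ : ∀ ρ → ASat M (instAtom ρ) → ASat M′ ρ
    instAtom⁺ (k₁ ≐ k₂) p = trans (sym (⟦instₙ⟧ k₁)) (trans p (⟦instₙ⟧ k₂))
    instAtom⁺ (npr l k) = subst (λ v → np M l (v ∷ [])) (⟦instₙ⟧ k)
    instAtom⁺ (teq k {s} t₁ t₂) p =
      trans (sym (⟦instₜ⟧ t₁)) (trans (cong (castCar M (⟦instₙ⟧ k) {s}) p) (⟦instₜ⟧ t₂))
    instAtom⁺ (rpr k ϖ ts) = subst (rp M ϖ) (⟦instᵣ⟧ ts)
    instAtom⁺ (fpr k π ts) = fp-cast M π (⟦instₙ⟧ k) (⟦instₐ⟧ ts)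

    instAtom⁻ : ∀ ρ → ASat M′ ρ → ASat M (instAtom ρ)
    instAtom⁻ (k₁ ≐ k₂) p = trans (⟦instₙ⟧ k₁) (trans p (sym (⟦instₙ⟧ k₂)))
    instAtom⁻ (npr l k) = subst (λ v → np M l (v ∷ [])) (sym (⟦instₙ⟧ k))
    instAtom⁻ (teq k {s} t₁ t₂) p =
      castCar-injective M {s = s} (⟦instₙ⟧ k) (trans (⟦instₜ⟧ t₁) (trans p (sym (⟦instₜ⟧ t₂))))
    instAtom⁻ (rpr k ϖ ts) = subst (rp M ϖ) (sym (⟦instᵣ⟧ ts))
    instAtom⁻ (fpr k π ts) = fp-uncast M π (⟦instₙ⟧ k) (⟦instₐ⟧ ts)

open Instantiate

module Lift {Δ : Sig} (X : Vars Δ) where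

  mutual
    liftₙ : NTerm Δ → NTerm (Δ [ X ])
    liftₙ (app σ ks) = app (old σ) (liftₙₛ ks)

    liftₙₛ : ∀ {n} → NTerms Δ n → NTerms (Δ [ X ]) n
    liftₙₛ [] = []
    liftₙₛ (k ∷ ks) = liftₙ k ∷ liftₙₛ ks

  mutual
    liftₜ : ∀ {k s} → HTerm Δ k s → HTerm (Δ [ X ]) (liftₙ k) s
    liftₜ (rig σ ts) = rig (old σ) (liftᵣ ts)
    liftₜ (flex σ ts) = flex σ (liftₐ ts)
    liftₜ (shift k₀ t) = shift (liftₙ k₀) (liftₜ t)

    liftᵣ : ∀ {k ar} → RArgs Δ k ar → RArgs (Δ [ X ]) (liftₙ k) ar
    liftᵣ [] = []
    liftᵣ (t ∷ ts) = liftₜ t ∷ liftᵣ ts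

    liftₐ : ∀ {k ar} → Args Δ k ar → Args (Δ [ X ]) (liftₙ k) ar
    liftₐ [] = []
    liftₐ (t ∷ ts) = liftₜ t ∷ liftₐ ts

  module _ (M : Model Δ) (vn : NV X → W M) (vr : ∀ {s} → RV X s → RC M s) where
    private
      M′ = expand X M vn vr

    mutual
      ⟦liftₙ⟧ : ∀ k → ⟦_⟧ₙ M′ (liftₙ k) ≡ ⟦_⟧ₙ M k
      ⟦liftₙ⟧ (app σ ks) = cong (nf M σ) (⟦liftₙₛ⟧ ks)

      ⟦liftₙₛ⟧ : ∀ {n} (ks : NTerms Δ n) → ⟦_⟧ₙₛ M′ (liftₙₛ ks) ≡ ⟦_⟧ₙₛ M ks
      ⟦liftₙₛ⟧ [] = refl
      ⟦liftₙₛ⟧ (k ∷ ks) = cong₂ _∷_ (⟦liftₙ⟧ k) (⟦liftₙₛ⟧ ks)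

    mutual
      ⟦liftₜ⟧ : ∀ {k s} (t : HTerm Δ k s) →
                castCar M (⟦liftₙ⟧ k) {s} (⟦_⟧ₜ M′ (liftₜ t)) ≡ ⟦_⟧ₜ M t
      ⟦liftₜ⟧ {k} (rig σ ts) = trans (castCar-rigid M (⟦liftₙ⟧ k) _) (cong (rf M σ) (⟦liftᵣ⟧ ts))
      ⟦liftₜ⟧ {k} (flex σ ts) = ff-cast M σ (⟦liftₙ⟧ k) (⟦liftₐ⟧ ts)
      ⟦liftₜ⟧ {k} (shift k₀ t) = trans (castCar-rigid M (⟦liftₙ⟧ k) _) (⟦liftₜ⟧-rigid t)

      ⟦liftₜ⟧-rigid : ∀ {k s} (t : HTerm Δ k (inj₁ s)) → ⟦_⟧ₜ M′ (liftₜ t) ≡ ⟦_⟧ₜ M t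
      ⟦liftₜ⟧-rigid {k} t = trans (sym (castCar-rigid M (⟦liftₙ⟧ k) _)) (⟦liftₜ⟧ t)

      ⟦liftᵣ⟧ : ∀ {k ar} (ts : RArgs Δ k ar) → ⟦_⟧ᵣ M′ (liftᵣ ts) ≡ ⟦_⟧ᵣ M ts
      ⟦liftᵣ⟧ [] = refl
      ⟦liftᵣ⟧ (t ∷ ts) = cong₂ _∷_ (⟦liftₜ⟧-rigid t) (⟦liftᵣ⟧ ts)

      ⟦liftₐ⟧ : ∀ {k ar} (ts : Args Δ k ar) →
                castArgs M (⟦liftₙ⟧ k) (⟦_⟧ₐ M′ (liftₐ ts)) ≡ ⟦_⟧ₐ M ts
      ⟦liftₐ⟧ [] = refl
      ⟦liftₐ⟧ (t ∷ ts) = cong₂ _∷_ (⟦liftₜ⟧ t) (⟦liftₐ⟧ ts)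

open Lift

-- Only rigid elements need names, since ∀ binds only nominal and rigid variables.
record ReachableCone {ι} {Δ : Sig} (M : Model Δ) {I : Set ι} (F : I → Model Δ) : Set ι where
  field
    hom          : ∀ i → Hom M (F i)
    reflect-atom : ∀ ρ → (∀ i → ASat (F i) ρ) → ASat M ρ
    reach-world  : ∀ w → Σ (NTerm Δ) λ k → ⟦_⟧ₙ M k ≡ w
    reach-rigid  : ∀ k {s} (x : RC M s) → Σ (HTerm Δ k (inj₁ s)) λ t → ⟦_⟧ₜ M t ≡ x
open ReachableCone

expand-ReachableCone :
  ∀ {ι} {Δ : Sig} {M : Model Δ} {I : Set ι} {F : I → Model Δ} {X : Vars Δ} →
  ReachableCone M F → (θ : Instantiation X) →
  ∀ {vn : NV X → W M} {vr : ∀ {s} → RV X s → RC M s}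
    {un : ∀ i → NV X → W (F i)} {ur : ∀ i {s} → RV X s → RC (F i) s} →
  Denotes M θ vn vr → (∀ i → Denotes (F i) θ (un i) (ur i)) →
  ReachableCone (expand X M vn vr) (λ i → expand X (F i) (un i) (ur i))
expand-ReachableCone {M = M} {F = F} {X = X} c θ {vn} {vr} {un} {ur} d dF = record
  { hom = λ i → expand-Hom X (hom c i) (hom-vn i) (hom-vr i)
  ; reflect-atom = λ ρ holds → instAtom⁺ θ M d ρ
      (reflect-atom c (instAtom θ ρ) (λ i → instAtom⁻ θ (F i) (dF i) ρ (holds i)))
  ; reach-world = λ w → let (k , k≡w) = reach-world c w in
      liftₙ X k , trans (⟦liftₙ⟧ X M vn vr k) k≡w
  ; reach-rigid = λ k x → let (t , t≡x) = reach-rigid c (instₙ θ k) x in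
      shift (liftₙ X (instₙ θ k)) (liftₜ X t) , trans (⟦liftₜ⟧-rigid X M vn vr t) t≡x
  }
  where
    hom-vn : ∀ i x → h (hom c i) (vn x) ≡ un i x
    hom-vn i x = begin
      h (hom c i) (vn x)                     ≡⟨ cong (h (hom c i)) (sym (nameₙ-≡ d x)) ⟩
      h (hom c i) (⟦_⟧ₙ M (nameₙ θ x))       ≡⟨ hom-⟦⟧ₙ (hom c i) (nameₙ θ x) ⟩
      ⟦_⟧ₙ (F i) (nameₙ θ x)                 ≡⟨ nameₙ-≡ (dF i) x ⟩
      un i x                                     ∎
      where open ≡-Reasoning

    hom-vr : ∀ i {s} (x : RV X s) → hr (hom c i) (vr x) ≡ ur i x
    hom-vr i x = begin
      hr (hom c i) (vr x)                    ≡⟨ cong (hr (hom c i)) (sym (nameᵣ-≡ d x)) ⟩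
      hr (hom c i) (⟦_⟧ₜ M (nameᵣ θ x))      ≡⟨ hom-⟦⟧ₜ-rigid (hom c i) (nameᵣ θ x) ⟩
      ⟦_⟧ₜ (F i) (nameᵣ θ x)                 ≡⟨ nameᵣ-≡ (dF i) x ⟩
      ur i x                                     ∎
      where open ≡-Reasoning

mutual
  reflect-Sat : ∀ {ι} {Δ : Sig} {M : Model Δ} {I : Set ι} {F : I → Model Δ} →
                ReachableCone M F → ∀ (γ : Horn Δ) (k : NTerm Δ) →
                (∀ i → Sat (F i) (⟦_⟧ₙ (F i) k) γ) → Sat M (⟦_⟧ₙ M k) γ
  reflect-Sat c (atom ρ) k holds = reflect-atom c ρ holds
  reflect-Sat c (at k′ γ) k holds = reflect-Sat c γ k′ holds
  reflect-Sat c (imp Hs γ) k holds hyps =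
    reflect-Sat c γ k (λ i → holds i (All.map (λ {H} → hom-HSat (hom c i) {H}) hyps))
  reflect-Sat c (box a γ) k holds w′ step with reach-world c w′
  ... | k′ , refl =
    reflect-Sat c γ k′ (λ i → holds i _ (hom-HSat (hom c i) {actH a k k′} step))
  reflect-Sat c (dia σ γ) k holds = reflect-Sat c γ (app σ (k ∷ [])) holds
  reflect-Sat {Δ = Δ} {M = M} {F = F} c (bind γ) k holds =
    reflect-Sat-expand c θ (names-current M) (λ i → names-current (F i)) γ holds
    where
      θ : Instantiation (oneNom Δ)
      θ = record { base = k ; nameₙ = λ _ → k ; nameᵣ = λ () }

      names-current : ∀ N {vr : ∀ {s} → RV (oneNom Δ) s → RC N s} → Denotes N θ (λ _ → ⟦_⟧ₙ N k) vr
      names-current N = record { nameₙ-≡ = λ _ → refl ; nameᵣ-≡ = λ () }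
  reflect-Sat {M = M} {F = F} c (all X γ) k holds vn vr =
    reflect-Sat-expand c θ d (λ i → canonical (F i)) γ (λ i → holds i _ _)
    where
      θ : Instantiation X
      θ = record
        { base = k
        ; nameₙ = λ x → proj₁ (reach-world c (vn x))
        ; nameᵣ = λ x → proj₁ (reach-rigid c k (vr x)) }

      d : Denotes M θ vn vr
      d = record
        { nameₙ-≡ = λ x → proj₂ (reach-world c (vn x))
        ; nameᵣ-≡ = λ x → proj₂ (reach-rigid c k (vr x)) }

      canonical : ∀ N → Denotes N θ (λ x → ⟦_⟧ₙ N (nameₙ θ x)) (λ x → ⟦_⟧ₜ N (nameᵣ θ x))
      canonical N = record { nameₙ-≡ = λ _ → refl ; nameᵣ-≡ = λ _ → refl }

  reflect-Sat-expand :
    ∀ {ι} {Δ : Sig} {M : Model Δ} {I : Set ι} {F : I → Model Δ} {X : Vars Δ} →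
    ReachableCone M F → (θ : Instantiation X) →
    ∀ {vn : NV X → W M} {vr : ∀ {s} → RV X s → RC M s}
    {un : ∀ i → NV X → W (F i)} {ur : ∀ i {s} → RV X s → RC (F i) s} →
    Denotes M θ vn vr → (∀ i → Denotes (F i) θ (un i) (ur i)) →
    ∀ (γ : Horn (Δ [ X ])) →
    (∀ i → Sat (expand X (F i) (un i) (ur i)) (⟦_⟧ₙ (F i) (base θ)) γ) →
    Sat (expand X M vn vr) (⟦_⟧ₙ M (base θ)) γ
  reflect-Sat-expand {M = M} {F = F} {X = X} c θ {vn} {vr} {un} {ur} d dF γ holds =
    subst (λ w → Sat (expand X M vn vr) w γ) (⟦liftₙ⟧ X M vn vr (base θ))
      (reflect-Sat (expand-ReachableCone c θ d dF) γ (liftₙ X (base θ))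
        (λ i → subst (λ w → Sat (expand X (F i) (un i) (ur i)) w γ)
                     (sym (⟦liftₙ⟧ X (F i) (un i) (ur i) (base θ))) (holds i)))

-- Every atom mentions a nominal term, so ⊨ yields ASat even for a model
-- without worlds.
atomNominal : ∀ {Δ} → Atom Δ → NTerm Δ
atomNominal (k ≐ _) = k
atomNominal (npr _ k) = k
atomNominal (teq k _ _) = k
atomNominal (rpr k _ _) = k
atomNominal (fpr k _ _) = k

⊨atom⇒ASat : ∀ {Δ} {M : Model Δ} ρ → M ⊨ atom ρ → ASat M ρ
⊨atom⇒ASat {M = M} ρ M⊨ρ = M⊨ρ (⟦_⟧ₙ M (atomNominal ρ))

ModelOf-Γ₀ : ∀ {ℓ Δ} {Γ : Horn Δ → Set ℓ} {N : Model Δ} → ModelOf Γ N → ModelOf (Γ₀ Γ) N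
ModelOf-Γ₀ {N = N} N⊨Γ γ (ρ , refl , Γ⊨ρ) = Γ⊨ρ N N⊨Γ

theorem14 : ∀ {ℓ : Level} (Δ : Sig) (Γ : Horn Δ → Set ℓ) (M : Model Δ) →
            Reachable M → IsInitial (Γ₀ Γ) M → IsInitial Γ M
theorem14 Δ Γ M (reach-w , reach-t) (M⊨Γ₀ , initial) =
  M⊨Γ , λ N N⊨Γ → initial N (ModelOf-Γ₀ N⊨Γ)
  where
    cone : ReachableCone M {I = Σ (Model Δ) (ModelOf Γ)} proj₁
    cone = record
      { hom = λ (N , N⊨Γ) → proj₁ (initial N (ModelOf-Γ₀ N⊨Γ))
      ; reflect-atom = λ ρ holds →
          ⊨atom⇒ASat ρ (M⊨Γ₀ (atom ρ) (ρ , refl , λ N N⊨Γ _ → holds (N , N⊨Γ)))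
      ; reach-world = reach-w
      ; reach-rigid = λ k x → reach-t k {inj₁ _} x
      }

    M⊨Γ : ModelOf Γ M
    M⊨Γ γ γ∈Γ w with reach-w w
    ... | k , refl = reflect-Sat cone γ k (λ (N , N⊨Γ) → N⊨Γ γ γ∈Γ _)
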